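{- Let $q,h,k$ be integers with $k\geq 1$ and $2\leq h\leq \lfloor q/2\rfloor$. Let $L_{q,h,k}$ be the link of $k$ pairwise disjoint copies $Z_1,\ldots,Z_k$ of the cycle $C_q$, with chosen vertices $x_i,y_i\in V(Z_i)$ at distance $h$ in $Z_i$, i.e. the graph obtained from $Z_1\cup\cdots\cup Z_k$ by adding the edges $y_ix_{i+1}$ for $i=1,\ldots,k-1$. Then $$SO(L_{q,h,k})=(2qk-5k+5)\sqrt{2}+(4k-4)\sqrt{13}.$$
   Context: For a finite simple graph $G$, $d_u$ denotes the degree of a vertex $u$ in $G$, and the Sombor index is $SO(G)=\sum_{uv\in E(G)}\sqrt{d_u^2+d_v^2}$. -}

module Defs where

open import Level using (Level)
open import Data.Nat as ℕ using (ℕ; zero; suc; _≡ᵇ_; _∸_; _⊓_; ∣_-_∣)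
open import Data.Bool using (Bool; true; false; _∧_; _∨_; if_then_else_)
open import Data.Fin using (Fin; toℕ; remQuot)
open import Data.Fin.Properties using (_≟_)
open import Data.List using (List; []; _∷_; foldr; filter; length; map; concatMap)
open import Data.List.Base using (allFin)
open import Data.Product using (_×_; _,_)
open import Relation.Nullary.Decidable using (⌊_⌋)
open import Relation.Binary.PropositionalEquality using (_≡_)
open import Algebra.Bundles using (CommutativeRing)

-- Graphs on vertex set Fin n, given by a Boolean adjacency relation
-- (intended symmetric and irreflexive: a finite simple graph).

Adj : ℕ → Set
Adj n = Fin n → Fin n → Bool

degree : ∀ {n} → Adj n → Fin n → ℕ
degree {n} adj u = length (filter (λ v → Data.Bool._≟_ (adj u v) true) (allFin n))

edges : ∀ {n} → Adj n → List (Fin n × Fin n)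
edges {n} adj =
  concatMap (λ u → map (λ v → (u , v))
    (filter (λ v → Data.Bool._≟_ (adj u v ∧ (toℕ u ℕ.<ᵇ toℕ v)) true) (allFin n)))
  (allFin n)

-- Real-valued quantities: we work in an arbitrary commutative ring R
-- equipped with a "square root" on natural numbers satisfying the
-- characteristic identities of the real square root on ℕ.

module _ {c ℓ : Level} (R : CommutativeRing c ℓ) where
  open CommutativeRing R

  fromℕ : ℕ → Carrier
  fromℕ zero    = 0#
  fromℕ (suc n) = 1# + fromℕ n

  record SqrtOn : Set (c Level.⊔ ℓ) where
    field
      √_      : ℕ → Carrier
      √-mult  : ∀ m n → √ (m ℕ.* n) ≈ (√ m) * (√ n)
      √-sq    : ∀ n → √ (n ℕ.* n) ≈ fromℕ n

  SO : SqrtOn → ∀ {n} → Adj n → Carrier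
  SO S adj = foldr _+_ 0#
    (map (λ e → let u = Data.Product.proj₁ e ; v = Data.Product.proj₂ e
                    du = degree adj u ; dv = degree adj v
                in √ (du ℕ.* du ℕ.+ dv ℕ.* dv))
         (edges adj))
    where open SqrtOn S

cycleAdjℕ : ℕ → ℕ → ℕ → Bool
cycleAdjℕ q a b = (b ≡ᵇ suc a) ∨ (a ≡ᵇ suc b)
                ∨ ((a ≡ᵇ (q ∸ 1)) ∧ (b ≡ᵇ 0)) ∨ ((b ≡ᵇ (q ∸ 1)) ∧ (a ≡ᵇ 0))

cycleDist : (q : ℕ) → Fin q → Fin q → ℕ
cycleDist q a b = ∣ toℕ a - toℕ b ∣ ⊓ (q ∸ ∣ toℕ a - toℕ b ∣)

-- The link L_{q,h,k}: vertex (i , a) ∈ Fin k × Fin q (copy Z_i, vertex a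
-- of C_q), encoded in Fin (k * q) via remQuot.  x i, y i are the chosen
-- vertices of Z_i.

finEq : ∀ {m} → Fin m → Fin m → Bool
finEq a b = ⌊ a ≟ b ⌋

linkAdj : (q k : ℕ) → (x y : Fin k → Fin q) → Adj (k ℕ.* q)
linkAdj q k x y u v with remQuot {k} q u | remQuot {k} q v
... | (i , a) | (j , b) =
  (finEq i j ∧ cycleAdjℕ q (toℕ a) (toℕ b))
  ∨ ((toℕ j ≡ᵇ suc (toℕ i)) ∧ finEq a (y i) ∧ finEq b (x j))
  ∨ ((toℕ i ≡ᵇ suc (toℕ j)) ∧ finEq b (y j) ∧ finEq a (x i))

-- All vertices of L_{q,h,k} have degree 2 except the 2(k − 1) attachment vertices y_i (i < k − 1) and
-- x_i (0 < i), which have degree 3; as h ≥ 2, no two of them are equal or adjacent within a cycle.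
-- So every edge contributes √8 = 2√2, √13 or √18 = 3√2, and SO = N₂·√2 + N₁₃·√13 with N₂, N₁₃ ∈ ℕ.
-- The k − 1 link edges join two degree-3 vertices. Each degree-3 vertex lies on two cycle edges, all of
-- type (2, 3), so N₁₃ = 4(k − 1); and √2-part + 2·√13-part equals 2 on every cycle edge, so
-- N₂ + 2·N₁₃ = 2qk + 3(k − 1).

module Submission where

open import Defs
open import Level using (Level)
open import Data.Nat using (ℕ; _≤_; _*_; _/_)
open import Data.Fin using (Fin)
open import Relation.Binary.PropositionalEquality using (_≡_)
open import Algebra.Bundles using (CommutativeRing)

import Algebra.Properties.Group as GroupProperties
open import Data.Bool as Bool using (Bool; true; false; T; _∧_; _∨_; if_then_else_)
open import Data.Bool.Properties using (T-∧; if-∧; if-swap-then; if-eta)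
open import Data.Empty using (⊥; ⊥-elim)
open import Data.Fin using (zero; suc; toℕ; combine; quotRem; remQuot; _↑ˡ_; _↑ʳ_)
open import Data.Fin.Properties using (_≟_; toℕ<n; remQuot-combine; combine-remQuot; toℕ-combine; combine-monoˡ-<)
open import Data.List using (List; []; _∷_; _++_; map; foldr; filter; length; concatMap; tabulate; allFin)
open import Data.List.Properties using (map-++; map-∘)
open import Data.Maybe using (nothing)
open import Data.Nat using (zero; suc; _+_; _∸_; _⊓_; ∣_-_∣; _≡ᵇ_; _<ᵇ_; _<_; z≤n; s≤s)
open import Data.Nat.ListAction using (sum)
open import Data.Nat.ListAction.Properties using (sum-++)
import Data.Nat.Properties as ℕ
open import Data.Nat.Properties using (≡ᵇ⇒≡; ≡⇒≡ᵇ; <ᵇ⇒<; <⇒<ᵇ; n<1+n; suc-injective; 1+n≢0)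
open import Data.Nat.Solver using (module +-*-Solver)
open import Data.Product using (_×_; _,_; proj₁; swap; uncurry)
open import Data.Sum using (_⊎_; inj₁; inj₂)
open import Function using (_∘_; Equivalence)
open import Relation.Binary.PropositionalEquality using (_≢_; refl; sym; trans; cong; cong₂; subst; subst₂; module ≡-Reasoning)
open import Relation.Nullary using (¬_; yes; no; _because_)
open import Relation.Nullary.Decidable using (toWitness)
open import Tactic.RingSolver.Core.AlmostCommutativeRing using (fromCommutativeRing)
import Tactic.RingSolver.NonReflective as RingSolver

open import Algebra.Properties.CommutativeMonoid.Sum ℕ.+-0-commutativeMonoid
  using (sum-syntax; sum-cong-≗; sum-replicate-zero; ∑-distrib-+)
open +-*-Solver using (solve; _:+_; _:*_; _:=_; con)

∑-const : ∀ n c → ∑[ i < n ] c ≡ n * c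
∑-const zero    c = refl
∑-const (suc n) c = cong (c +_) (∑-const n c)

∑-last : ∀ n (g : ℕ → ℕ) → ∑[ m < suc n ] g (toℕ m) ≡ ∑[ m < n ] g (toℕ m) + g n
∑-last zero    g = ℕ.+-comm (g 0) 0
∑-last (suc n) g = trans (cong (g 0 +_) (∑-last n (g ∘ suc))) (sym (ℕ.+-assoc (g 0) _ _))

∑-↑ : ∀ m n (f : Fin (m + n) → ℕ) → ∑[ u < m + n ] f u ≡ ∑[ i < m ] f (i ↑ˡ n) + ∑[ j < n ] f (m ↑ʳ j)
∑-↑ zero    n f = refl
∑-↑ (suc m) n f = trans (cong (f zero +_) (∑-↑ m n (f ∘ suc))) (sym (ℕ.+-assoc (f zero) _ _))

∑-combine : ∀ m n (f : Fin (m * n) → ℕ) → ∑[ u < m * n ] f u ≡ ∑[ i < m ] ∑[ a < n ] f (combine i a)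
∑-combine zero    n f = refl
∑-combine (suc m) n f = trans (∑-↑ n (m * n) f) (cong (∑[ a < n ] f (a ↑ˡ (m * n)) +_) (∑-combine m n (f ∘ (n ↑ʳ_))))

∑-distrib-+₃ : ∀ n (f g h : Fin n → ℕ) →
  ∑[ i < n ] (f i + (g i + h i)) ≡ ∑[ i < n ] f i + (∑[ i < n ] g i + ∑[ i < n ] h i)
∑-distrib-+₃ n f g h = trans (∑-distrib-+ {n} f _) (cong (∑[ i < n ] f i +_) (∑-distrib-+ {n} g h))

∑-cycle-pairs : ∀ n (e : ℕ → ℕ) → ∑[ m < n ] (e (toℕ m) + e (suc (toℕ m))) + (e 0 + e n)
  ≡ ∑[ m < suc n ] e (toℕ m) + ∑[ m < suc n ] e (toℕ m)
∑-cycle-pairs n e = begin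
  ∑[ m < n ] (e (toℕ m) + e (suc (toℕ m))) + (e 0 + e n)
    ≡⟨ cong (_+ (e 0 + e n)) (∑-distrib-+ {n} (e ∘ toℕ) (e ∘ suc ∘ toℕ)) ⟩
  (∑[ m < n ] e (toℕ m) + ∑[ m < n ] e (suc (toℕ m))) + (e 0 + e n)
    ≡⟨ solve 4 (λ A B z w → (A :+ B) :+ (z :+ w) := (A :+ w) :+ (z :+ B)) refl
         (∑[ m < n ] e (toℕ m)) (∑[ m < n ] e (suc (toℕ m))) (e 0) (e n) ⟩
  (∑[ m < n ] e (toℕ m) + e n) + (e 0 + ∑[ m < n ] e (suc (toℕ m)))
    ≡⟨ cong (_+ (e 0 + ∑[ m < n ] e (suc (toℕ m)))) (sym (∑-last n e)) ⟩
  ∑[ m < suc n ] e (toℕ m) + ∑[ m < suc n ] e (toℕ m) ∎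
  where open ≡-Reasoning

if-T : ∀ {c} r → T c → (if c then r else 0) ≡ r
if-T {true} r _ = refl

if-F : ∀ {c} r → ¬ T c → (if c then r else 0) ≡ 0
if-F {true}  r ¬c = ⊥-elim (¬c _)
if-F {false} r _  = refl

if≤ : ∀ c n → (if c then n else 0) ≤ n
if≤ true  n = ℕ.≤-refl
if≤ false n = z≤n

if-congᵀ : ∀ c {x y} → (T c → x ≡ y) → (if c then x else 0) ≡ (if c then y else 0)
if-congᵀ true  x≡y = x≡y _
if-congᵀ false _   = refl

Disjoint : Bool → Bool → Set
Disjoint a b = T a → T b → ⊥

disjoint-∨ : ∀ {a b c} → Disjoint a b → Disjoint a c → Disjoint a (b ∨ c)
disjoint-∨ {b = true}  a⊥b _   ta _  = a⊥b ta _
disjoint-∨ {b = false} _   a⊥c ta tc = a⊥c ta tc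

disjoint-∧ : ∀ {a b c d} → Disjoint a c → Disjoint (a ∧ b) (c ∧ d)
disjoint-∧ a⊥c ab cd = a⊥c (proj₁ (Equivalence.to T-∧ ab)) (proj₁ (Equivalence.to T-∧ cd))

if-∨-disjoint : ∀ {a b} r → Disjoint a b → (if a ∨ b then r else 0) ≡ (if a then r else 0) + (if b then r else 0)
if-∨-disjoint {true}  {true}  r a⊥b = ⊥-elim (a⊥b _ _)
if-∨-disjoint {true}  {false} r _   = sym (ℕ.+-identityʳ r)
if-∨-disjoint {false}         r _   = refl

∑-if : ∀ n b (f : Fin n → ℕ) → ∑[ i < n ] (if b then f i else 0) ≡ (if b then ∑[ i < n ] f i else 0)
∑-if n true  f = refl
∑-if n false f = sum-replicate-zero n

≡ᵇ-comm : ∀ m n → (m ≡ᵇ n) ≡ (n ≡ᵇ m)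
≡ᵇ-comm zero    zero    = refl
≡ᵇ-comm zero    (suc n) = refl
≡ᵇ-comm (suc m) zero    = refl
≡ᵇ-comm (suc m) (suc n) = ≡ᵇ-comm m n

+-<ᵇ : ∀ c m n → (c + m <ᵇ c + n) ≡ (m <ᵇ n)
+-<ᵇ zero    m n = refl
+-<ᵇ (suc c) m n = +-<ᵇ c m n

<ᵇ+≡ᵇ : ∀ {m n} → m ≤ n → (if m <ᵇ n then 1 else 0) + (if m ≡ᵇ n then 1 else 0) ≡ 1
<ᵇ+≡ᵇ {zero}  {zero}  _         = refl
<ᵇ+≡ᵇ {zero}  {suc n} _         = refl
<ᵇ+≡ᵇ {suc m} {suc n} (s≤s m≤n) = <ᵇ+≡ᵇ m≤n

∑-δℕ : ∀ n c (g : ℕ → ℕ) → ∑[ j < n ] (if toℕ j ≡ᵇ c then g (toℕ j) else 0) ≡ (if c <ᵇ n then g c else 0)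
∑-δℕ zero    c       g = refl
∑-δℕ (suc n) zero    g = trans (cong (g 0 +_) (sum-replicate-zero n)) (ℕ.+-identityʳ (g 0))
∑-δℕ (suc n) (suc c) g = ∑-δℕ n c (g ∘ suc)

∑-δℕ-pred : ∀ n c r → c ≤ n → ∑[ j < n ] (if c ≡ᵇ suc (toℕ j) then r else 0) ≡ (if 0 <ᵇ c then r else 0)
∑-δℕ-pred n zero    r _   = sum-replicate-zero n
∑-δℕ-pred n (suc c) r c<n = begin
  ∑[ j < n ] (if c ≡ᵇ toℕ j then r else 0)
    ≡⟨ sum-cong-≗ {n} (λ j → cong (λ b → if b then r else 0) (≡ᵇ-comm c (toℕ j))) ⟩
  ∑[ j < n ] (if toℕ j ≡ᵇ c then r else 0)
    ≡⟨ ∑-δℕ n c (λ _ → r) ⟩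
  (if c <ᵇ n then r else 0)
    ≡⟨ if-T r (<⇒<ᵇ c<n) ⟩
  r ∎
  where open ≡-Reasoning

∑-count-< : ∀ n m c → ∑[ i < n ] (if toℕ i <ᵇ m then c else 0) ≡ (n ⊓ m) * c
∑-count-< zero    m       c = refl
∑-count-< (suc n) zero    c = sum-replicate-zero (suc n)
∑-count-< (suc n) (suc m) c = cong (c +_) (∑-count-< n m c)

-- Not definitional: ⌊_⌋ matches on the decision, which map′ leaves stuck.
finEq-suc : ∀ {n} (i j : Fin n) → finEq (suc i) (suc j) ≡ finEq i j
finEq-suc i j with i ≟ j
... | true  because _ = refl
... | false because _ = refl

finEq-toℕ : ∀ {n} (a b : Fin n) → finEq a b ≡ (toℕ a ≡ᵇ toℕ b)
finEq-toℕ zero    zero    = refl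
finEq-toℕ zero    (suc b) = refl
finEq-toℕ (suc a) zero    = refl
finEq-toℕ (suc a) (suc b) = trans (finEq-suc a b) (finEq-toℕ a b)

∑-δ : ∀ {n} (i : Fin n) (f : Fin n → ℕ) → ∑[ j < n ] (if finEq i j then f j else 0) ≡ f i
∑-δ {suc n} zero    f = trans (cong (f zero +_) (sum-replicate-zero n)) (ℕ.+-identityʳ (f zero))
∑-δ {suc n} (suc i) f =
  trans (sum-cong-≗ {n} (λ j → cong (λ b → if b then f (suc j) else 0) (finEq-suc i j))) (∑-δ i (f ∘ suc))

∑-δʳ : ∀ {n} (i : Fin n) (f : Fin n → ℕ) → ∑[ j < n ] (if finEq j i then f j else 0) ≡ f i
∑-δʳ {suc n} zero    f = trans (cong (f zero +_) (sum-replicate-zero n)) (ℕ.+-identityʳ (f zero))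
∑-δʳ {suc n} (suc i) f =
  trans (sum-cong-≗ {n} (λ j → cong (λ b → if b then f (suc j) else 0) (finEq-suc j i))) (∑-δʳ i (f ∘ suc))

sum-map-concatMap : ∀ {A B : Set} (g : A → List B) (f : B → ℕ) xs →
  sum (map f (concatMap g xs)) ≡ sum (map (λ a → sum (map f (g a))) xs)
sum-map-concatMap g f []       = refl
sum-map-concatMap g f (x ∷ xs) = begin
  sum (map f (g x ++ concatMap g xs))               ≡⟨ cong sum (map-++ f (g x) _) ⟩
  sum (map f (g x) ++ map f (concatMap g xs))       ≡⟨ sum-++ (map f (g x)) _ ⟩
  sum (map f (g x)) + sum (map f (concatMap g xs))  ≡⟨ cong (sum (map f (g x)) +_) (sum-map-concatMap g f xs) ⟩
  sum (map f (g x)) + sum (map (λ a → sum (map f (g a))) xs) ∎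
  where open ≡-Reasoning

sum-map-filter : ∀ {A : Set} (b : A → Bool) (f : A → ℕ) xs →
  sum (map f (filter (λ a → b a Bool.≟ true) xs)) ≡ sum (map (λ a → if b a then f a else 0) xs)
sum-map-filter b f []       = refl
sum-map-filter b f (x ∷ xs) with b x
... | true  = cong (f x +_) (sum-map-filter b f xs)
... | false = sum-map-filter b f xs

length-filter : ∀ {A : Set} (b : A → Bool) xs →
  length (filter (λ a → b a Bool.≟ true) xs) ≡ sum (map (λ a → if b a then 1 else 0) xs)
length-filter b []       = refl
length-filter b (x ∷ xs) with b x
... | true  = cong suc (length-filter b xs)
... | false = length-filter b xs

sum-map-tabulate : ∀ {A : Set} n (g : Fin n → A) (f : A → ℕ) → sum (map f (tabulate g)) ≡ ∑[ i < n ] f (g i)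
sum-map-tabulate zero    g f = refl
sum-map-tabulate (suc n) g f = cong (f (g zero) +_) (sum-map-tabulate n (g ∘ suc) f)

sum-map-+* : ∀ {A : Set} (f g : A → ℕ) c xs → sum (map (λ a → f a + c * g a) xs) ≡ sum (map f xs) + c * sum (map g xs)
sum-map-+* f g c []       = sym (ℕ.*-zeroʳ c)
sum-map-+* f g c (a ∷ as) = trans (cong ((f a + c * g a) +_) (sum-map-+* f g c as))
  (solve 5 (λ F G C S T → (F :+ C :* G) :+ (S :+ C :* T) := (F :+ S) :+ C :* (G :+ T)) refl
    (f a) (g a) c (sum (map f as)) (sum (map g as)))

∑edges : ∀ {n} → Adj n → (Fin n → Fin n → ℕ) → ℕ
∑edges adj w = sum (map (uncurry w) (edges adj))

∑edges-as-∑∑ : ∀ {n} (adj : Adj n) (w : Fin n → Fin n → ℕ) →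
  ∑edges adj w ≡ ∑[ u < n ] ∑[ v < n ] (if adj u v ∧ (toℕ u <ᵇ toℕ v) then w u v else 0)
∑edges-as-∑∑ {n} adj w = begin
  sum (map (uncurry w) (concatMap (λ u → map (u ,_) (upper-neighbours u)) (allFin n)))
    ≡⟨ sum-map-concatMap _ (uncurry w) (allFin n) ⟩
  sum (map (λ u → sum (map (uncurry w) (map (u ,_) (upper-neighbours u)))) (allFin n))
    ≡⟨ sum-map-tabulate n (λ u → u) _ ⟩
  ∑[ u < n ] sum (map (uncurry w) (map (u ,_) (upper-neighbours u)))
    ≡⟨ sum-cong-≗ {n} (λ u → cong sum (sym (map-∘ (upper-neighbours u)))) ⟩
  ∑[ u < n ] sum (map (w u) (upper-neighbours u))
    ≡⟨ sum-cong-≗ {n} (λ u → sum-map-filter (λ v → adj u v ∧ (toℕ u <ᵇ toℕ v)) (w u) (allFin n)) ⟩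
  ∑[ u < n ] sum (map (λ v → if adj u v ∧ (toℕ u <ᵇ toℕ v) then w u v else 0) (allFin n))
    ≡⟨ sum-cong-≗ {n} (λ u → sum-map-tabulate n (λ v → v) _) ⟩
  ∑[ u < n ] ∑[ v < n ] (if adj u v ∧ (toℕ u <ᵇ toℕ v) then w u v else 0) ∎
  where
  open ≡-Reasoning
  upper-neighbours : Fin n → List (Fin n)
  upper-neighbours u = filter (λ v → adj u v ∧ (toℕ u <ᵇ toℕ v) Bool.≟ true) (allFin n)

degree-as-∑ : ∀ {n} (adj : Adj n) u → degree adj u ≡ ∑[ v < n ] (if adj u v then 1 else 0)
degree-as-∑ {n} adj u = trans (length-filter (adj u) (allFin n)) (sum-map-tabulate n (λ v → v) _)

-- The Sombor index of a graph with all degrees in {2, 3}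

-- √(d² + d′²) = √2-part d d′ · √2 + √13-part d d′ · √13 for d, d′ ∈ {2, 3}.
√2-part √13-part : ℕ → ℕ → ℕ
√2-part 2 2 = 2
√2-part 3 3 = 3
√2-part _ _ = 0
√13-part 2 3 = 1
√13-part 3 2 = 1
√13-part _ _ = 0

√2-coefficient √13-coefficient : ∀ {n} → Adj n → ℕ
√2-coefficient  adj = ∑edges adj (λ u v → √2-part (degree adj u) (degree adj v))
√13-coefficient adj = ∑edges adj (λ u v → √13-part (degree adj u) (degree adj v))

Is2or3 : ℕ → Set
Is2or3 d = d ≡ 2 ⊎ d ≡ 3

module _ {c ℓ : Level} (R : CommutativeRing c ℓ) (S : SqrtOn R) where
  open CommutativeRing R
    using (Carrier; _≈_; _-_; 0#; 1#; setoid; +-group; +-cong; +-congˡ; +-congʳ; *-congʳ; +-assoc;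
           +-identityˡ; +-identityʳ; *-identityˡ; zeroˡ)
    renaming (_+_ to _+ᴿ_; _*_ to _*ᴿ_; refl to ≈-refl; sym to ≈-sym; trans to ≈-trans; reflexive to ≈-reflexive)
  open SqrtOn S
  open import Relation.Binary.Reasoning.Setoid setoid
  open RingSolver (fromCommutativeRing R (λ _ → nothing)) using (_⊜_; _⊕_; _⊗_; ⊝_) renaming (solve to solveᴿ)
  open GroupProperties +-group using (x≈z//y)

  fromℕ-+ : ∀ m n → fromℕ R (m + n) ≈ fromℕ R m +ᴿ fromℕ R n
  fromℕ-+ zero    n = ≈-sym (+-identityˡ _)
  fromℕ-+ (suc m) n = ≈-trans (+-congˡ (fromℕ-+ m n)) (≈-sym (+-assoc _ _ _))

  fromℕ-cancel : ∀ m n o → m + n ≡ o → fromℕ R m ≈ fromℕ R o - fromℕ R n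
  fromℕ-cancel m n o m+n≡o = x≈z//y _ _ _ (≈-trans (≈-sym (fromℕ-+ m n)) (≈-reflexive (cong (fromℕ R) m+n≡o)))

  fromℕ-rearrange : ∀ m n o d → m + n ≡ o + d → fromℕ R m ≈ (fromℕ R o - fromℕ R n) +ᴿ fromℕ R d
  fromℕ-rearrange m n o d eq = begin
    fromℕ R m                              ≈⟨ fromℕ-cancel m n (o + d) eq ⟩
    fromℕ R (o + d) - fromℕ R n            ≈⟨ +-congʳ (fromℕ-+ o d) ⟩
    (fromℕ R o +ᴿ fromℕ R d) - fromℕ R n   ≈⟨ solveᴿ 3 (λ a b c → ((a ⊕ b) ⊕ ⊝ c) ⊜ ((a ⊕ ⊝ c) ⊕ b)) ≈-refl
                                                (fromℕ R o) (fromℕ R d) (fromℕ R n) ⟩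
    (fromℕ R o - fromℕ R n) +ᴿ fromℕ R d   ∎

  foldr-+-linear : ∀ {A : Set} (α β : A → ℕ) (w : A → Carrier) (a b : Carrier) →
    (∀ e → w e ≈ fromℕ R (α e) *ᴿ a +ᴿ fromℕ R (β e) *ᴿ b) → ∀ es →
    foldr _+ᴿ_ 0# (map w es) ≈ fromℕ R (sum (map α es)) *ᴿ a +ᴿ fromℕ R (sum (map β es)) *ᴿ b
  foldr-+-linear α β w a b w≈ []       = ≈-sym (≈-trans (+-cong (zeroˡ a) (zeroˡ b)) (+-identityˡ 0#))
  foldr-+-linear α β w a b w≈ (e ∷ es) = begin
    w e +ᴿ foldr _+ᴿ_ 0# (map w es)
      ≈⟨ +-cong (w≈ e) (foldr-+-linear α β w a b w≈ es) ⟩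
    (A *ᴿ a +ᴿ B *ᴿ b) +ᴿ (A′ *ᴿ a +ᴿ B′ *ᴿ b)
      ≈⟨ solveᴿ 6 (λ x y x′ y′ a b → ((x ⊗ a ⊕ y ⊗ b) ⊕ (x′ ⊗ a ⊕ y′ ⊗ b)) ⊜ ((x ⊕ x′) ⊗ a ⊕ (y ⊕ y′) ⊗ b))
           ≈-refl A B A′ B′ a b ⟩
    (A +ᴿ A′) *ᴿ a +ᴿ (B +ᴿ B′) *ᴿ b
      ≈⟨ ≈-sym (+-cong (*-congʳ (fromℕ-+ (α e) _)) (*-congʳ (fromℕ-+ (β e) _))) ⟩
    fromℕ R (sum (map α (e ∷ es))) *ᴿ a +ᴿ fromℕ R (sum (map β (e ∷ es))) *ᴿ b ∎
    where
    A B A′ B′ : Carrier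
    A  = fromℕ R (α e)
    B  = fromℕ R (β e)
    A′ = fromℕ R (sum (map α es))
    B′ = fromℕ R (sum (map β es))

  √-2m² : ∀ m → √ (m * m * 2) ≈ fromℕ R m *ᴿ √ 2 +ᴿ fromℕ R 0 *ᴿ √ 13
  √-2m² m = ≈-trans (√-mult (m * m) 2)
    (≈-trans (*-congʳ (√-sq m)) (≈-sym (≈-trans (+-congˡ (zeroˡ _)) (+-identityʳ _))))

  √13-as-combination : √ 13 ≈ fromℕ R 0 *ᴿ √ 2 +ᴿ fromℕ R 1 *ᴿ √ 13
  √13-as-combination = ≈-sym (≈-trans (+-cong (zeroˡ _) (≈-trans (*-congʳ (+-identityʳ 1#)) (*-identityˡ _))) (+-identityˡ _))

  √-sum-of-squares : ∀ {d d′} → Is2or3 d → Is2or3 d′ →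
    √ (d * d + d′ * d′) ≈ fromℕ R (√2-part d d′) *ᴿ √ 2 +ᴿ fromℕ R (√13-part d d′) *ᴿ √ 13
  √-sum-of-squares (inj₁ refl) (inj₁ refl) = √-2m² 2
  √-sum-of-squares (inj₁ refl) (inj₂ refl) = √13-as-combination
  √-sum-of-squares (inj₂ refl) (inj₁ refl) = √13-as-combination
  √-sum-of-squares (inj₂ refl) (inj₂ refl) = √-2m² 3

  SO-of-2-3-degrees : ∀ {n} (adj : Adj n) → (∀ u → Is2or3 (degree adj u)) →
    SO R S adj ≈ fromℕ R (√2-coefficient adj) *ᴿ √ 2 +ᴿ fromℕ R (√13-coefficient adj) *ᴿ √ 13
  SO-of-2-3-degrees adj is2or3 =
    foldr-+-linear _ _ _ (√ 2) (√ 13) (λ (u , v) → √-sum-of-squares (is2or3 u) (is2or3 v)) (edges adj)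

-- The cycle C_q

-- q = 3 + r, so that q ∸ 1 computes to p.
module Cycle (r : ℕ) where

  p q : ℕ
  p = 2 + r
  q = 3 + r

  private
    ≡ᵇ-∧⇒ : ∀ a m b n → T ((a ≡ᵇ m) ∧ (b ≡ᵇ n)) → a ≡ m × b ≡ n
    ≡ᵇ-∧⇒ _ _ _ _ t with Equivalence.to T-∧ t
    ... | s , u = ≡ᵇ⇒≡ _ _ s , ≡ᵇ⇒≡ _ _ u

    n≢2+n : ∀ {n} → n ≡ 2 + n → ⊥
    n≢2+n {suc n} eq = n≢2+n (suc-injective eq)

    p≢0 : p ≡ 0 → ⊥
    p≢0 ()

    p≢1 : p ≡ 1 → ⊥
    p≢1 ()

  cycle-indicator : ∀ a b x → (if cycleAdjℕ q a b then x else 0)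
    ≡ (if b ≡ᵇ suc a then x else 0) + ((if a ≡ᵇ suc b then x else 0)
      + ((if a ≡ᵇ p then (if b ≡ᵇ 0 then x else 0) else 0) + (if a ≡ᵇ 0 then (if b ≡ᵇ p then x else 0) else 0)))
  cycle-indicator a b x = begin
    (if cycleAdjℕ q a b then x else 0)
      ≡⟨ if-∨-disjoint x (disjoint-∨ succ⊥pred (disjoint-∨ succ⊥wrap succ⊥wrap′)) ⟩
    [ b ≡ᵇ suc a ] + (if (a ≡ᵇ suc b) ∨ wrap ∨ wrap′ then x else 0)
      ≡⟨ cong ([ b ≡ᵇ suc a ] +_) (if-∨-disjoint x (disjoint-∨ pred⊥wrap pred⊥wrap′)) ⟩
    [ b ≡ᵇ suc a ] + ([ a ≡ᵇ suc b ] + (if wrap ∨ wrap′ then x else 0))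
      ≡⟨ cong (λ z → [ b ≡ᵇ suc a ] + ([ a ≡ᵇ suc b ] + z)) (if-∨-disjoint x wrap⊥wrap′) ⟩
    [ b ≡ᵇ suc a ] + ([ a ≡ᵇ suc b ] + ([ wrap ] + [ wrap′ ]))
      ≡⟨ cong (λ z → [ b ≡ᵇ suc a ] + ([ a ≡ᵇ suc b ] + z))
           (cong₂ _+_ (if-∧ (a ≡ᵇ p)) (trans (if-∧ (b ≡ᵇ p)) (if-swap-then (b ≡ᵇ p) (a ≡ᵇ 0)))) ⟩
    [ b ≡ᵇ suc a ] + ([ a ≡ᵇ suc b ]
      + ((if a ≡ᵇ p then [ b ≡ᵇ 0 ] else 0) + (if a ≡ᵇ 0 then [ b ≡ᵇ p ] else 0))) ∎
    where
    open ≡-Reasoning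
    [_] : Bool → ℕ
    [ c ] = if c then x else 0
    wrap wrap′ : Bool
    wrap  = (a ≡ᵇ p) ∧ (b ≡ᵇ 0)
    wrap′ = (b ≡ᵇ p) ∧ (a ≡ᵇ 0)
    succ⊥pred : Disjoint (b ≡ᵇ suc a) (a ≡ᵇ suc b)
    succ⊥pred s t = n≢2+n (trans (≡ᵇ⇒≡ a (suc b) t) (cong suc (≡ᵇ⇒≡ b (suc a) s)))
    succ⊥wrap : Disjoint (b ≡ᵇ suc a) wrap
    succ⊥wrap s w with ≡ᵇ-∧⇒ a p b 0 w
    ... | _ , b≡0 = 1+n≢0 (trans (sym (≡ᵇ⇒≡ _ _ s)) b≡0)
    succ⊥wrap′ : Disjoint (b ≡ᵇ suc a) wrap′
    succ⊥wrap′ s w with ≡ᵇ-∧⇒ b p a 0 w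
    ... | b≡p , a≡0 = p≢1 (trans (sym b≡p) (trans (≡ᵇ⇒≡ _ _ s) (cong suc a≡0)))
    pred⊥wrap : Disjoint (a ≡ᵇ suc b) wrap
    pred⊥wrap t w with ≡ᵇ-∧⇒ a p b 0 w
    ... | a≡p , b≡0 = p≢1 (trans (sym a≡p) (trans (≡ᵇ⇒≡ _ _ t) (cong suc b≡0)))
    pred⊥wrap′ : Disjoint (a ≡ᵇ suc b) wrap′
    pred⊥wrap′ t w with ≡ᵇ-∧⇒ b p a 0 w
    ... | _ , a≡0 = 1+n≢0 (trans (sym (≡ᵇ⇒≡ _ _ t)) a≡0)
    wrap⊥wrap′ : Disjoint wrap wrap′
    wrap⊥wrap′ w w′ with ≡ᵇ-∧⇒ a p b 0 w | ≡ᵇ-∧⇒ b p a 0 w′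
    ... | a≡p , _ | _ , a≡0 = p≢0 (trans (sym a≡p) a≡0)

  cycle-degree : ∀ a → a ≤ p → ∑[ b < q ] (if cycleAdjℕ q a (toℕ b) then 1 else 0) ≡ 2
  cycle-degree a a≤p = begin
    ∑[ b < q ] (if cycleAdjℕ q a (toℕ b) then 1 else 0)
      ≡⟨ sum-cong-≗ {q} (λ b → cycle-indicator a (toℕ b) 1) ⟩
    ∑[ b < q ] (forward b + (backward b + (wrap b + wrap′ b)))
      ≡⟨ ∑-distrib-+ {q} forward (λ b → backward b + (wrap b + wrap′ b)) ⟩
    ∑[ b < q ] forward b + ∑[ b < q ] (backward b + (wrap b + wrap′ b))
      ≡⟨ cong (∑[ b < q ] forward b +_) (∑-distrib-+₃ q backward wrap wrap′) ⟩
    ∑[ b < q ] forward b + (∑[ b < q ] backward b + (∑[ b < q ] wrap b + ∑[ b < q ] wrap′ b))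
      ≡⟨ cong₂ _+_ (∑-δℕ q (suc a) (λ _ → 1))
           (cong₂ _+_ (∑-δℕ-pred q a 1 (ℕ.m≤n⇒m≤1+n a≤p))
             (cong₂ _+_ (trans (∑-if q (a ≡ᵇ p) (λ b → [ toℕ b ≡ᵇ 0 ]))
                          (cong (λ z → if a ≡ᵇ p then z else 0) (∑-δℕ q 0 (λ _ → 1))))
                        (trans (∑-if q (a ≡ᵇ 0) (λ b → [ toℕ b ≡ᵇ p ])) (cong (λ z → if a ≡ᵇ 0 then z else 0)
                          (trans (∑-δℕ q p (λ _ → 1)) (if-T 1 (<⇒<ᵇ (n<1+n p)))))))) ⟩
    [ suc a <ᵇ q ] + ([ 0 <ᵇ a ] + ([ a ≡ᵇ p ] + [ a ≡ᵇ 0 ]))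
      ≡⟨ two-neighbours a a≤p ⟩
    2 ∎
    where
    open ≡-Reasoning
    [_] : Bool → ℕ
    [ c ] = if c then 1 else 0
    forward backward wrap wrap′ : Fin q → ℕ
    forward  b = [ toℕ b ≡ᵇ suc a ]
    backward b = [ a ≡ᵇ suc (toℕ b) ]
    wrap     b = if a ≡ᵇ p then [ toℕ b ≡ᵇ 0 ] else 0
    wrap′    b = if a ≡ᵇ 0 then [ toℕ b ≡ᵇ p ] else 0
    two-neighbours : ∀ a → a ≤ p → [ suc a <ᵇ q ] + ([ 0 <ᵇ a ] + ([ a ≡ᵇ p ] + [ a ≡ᵇ 0 ])) ≡ 2
    two-neighbours zero    _   = refl
    two-neighbours (suc a) a<p =
      trans (ℕ.+-suc [ suc a <ᵇ p ] _) (cong suc (trans (cong ([ suc a <ᵇ p ] +_) (ℕ.+-identityʳ _)) (<ᵇ+≡ᵇ a<p)))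

  forward-neighbours : ∀ (G : ℕ → ℕ → ℕ) a →
    ∑[ b < q ] (if cycleAdjℕ q a (toℕ b) ∧ (a <ᵇ toℕ b) then G a (toℕ b) else 0)
      ≡ (if suc a <ᵇ q then G a (suc a) else 0) + (if a ≡ᵇ 0 then G a p else 0)
  forward-neighbours G a = begin
    ∑[ b < q ] (if cycleAdjℕ q a (toℕ b) ∧ (a <ᵇ toℕ b) then G a (toℕ b) else 0)
      ≡⟨ sum-cong-≗ {q} (λ b → trans (if-∧ (cycleAdjℕ q a (toℕ b)) {a <ᵇ toℕ b} {G a (toℕ b)} {0})
                                     (cycle-indicator a (toℕ b) (h (toℕ b)))) ⟩
    ∑[ b < q ] (forward b + (backward b + (wrap b + wrap′ b)))
      ≡⟨ ∑-distrib-+ {q} forward (λ b → backward b + (wrap b + wrap′ b)) ⟩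
    ∑[ b < q ] forward b + ∑[ b < q ] (backward b + (wrap b + wrap′ b))
      ≡⟨ cong (∑[ b < q ] forward b +_) (∑-distrib-+₃ q backward wrap wrap′) ⟩
    ∑[ b < q ] forward b + (∑[ b < q ] backward b + (∑[ b < q ] wrap b + ∑[ b < q ] wrap′ b))
      ≡⟨ cong₂ _+_ forward-sum (cong₂ _+_ backward-sum (cong₂ _+_ wrap-sum wrap′-sum)) ⟩
    (if suc a <ᵇ q then G a (suc a) else 0) + (0 + (0 + (if a ≡ᵇ 0 then G a p else 0))) ∎
    where
    open ≡-Reasoning
    h : ℕ → ℕ
    h b = if a <ᵇ b then G a b else 0
    forward backward wrap wrap′ : Fin q → ℕ
    forward  b = if toℕ b ≡ᵇ suc a then h (toℕ b) else 0
    backward b = if a ≡ᵇ suc (toℕ b) then h (toℕ b) else 0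
    wrap     b = if a ≡ᵇ p then (if toℕ b ≡ᵇ 0 then h (toℕ b) else 0) else 0
    wrap′    b = if a ≡ᵇ 0 then (if toℕ b ≡ᵇ p then h (toℕ b) else 0) else 0
    forward-sum : ∑[ b < q ] forward b ≡ (if suc a <ᵇ q then G a (suc a) else 0)
    forward-sum = trans (∑-δℕ q (suc a) h)
      (if-congᵀ (suc a <ᵇ q) (λ _ → if-T (G a (suc a)) (<⇒<ᵇ (n<1+n a))))
    backward-sum : ∑[ b < q ] backward b ≡ 0
    backward-sum = trans (sum-cong-≗ {q} (λ b → trans (if-congᵀ (a ≡ᵇ suc (toℕ b)) (λ t → if-F (G a (toℕ b)) (λ lt →
        ℕ.<-asym (<ᵇ⇒< a (toℕ b) lt) (subst (toℕ b <_) (sym (≡ᵇ⇒≡ a _ t)) (n<1+n (toℕ b))))))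
        (if-eta (a ≡ᵇ suc (toℕ b)))))
      (sum-replicate-zero q)
    wrap-sum : ∑[ b < q ] wrap b ≡ 0
    wrap-sum = trans (∑-if q (a ≡ᵇ p) (λ b → if toℕ b ≡ᵇ 0 then h (toℕ b) else 0))
      (trans (cong (λ z → if a ≡ᵇ p then z else 0) (∑-δℕ q 0 h)) (if-eta (a ≡ᵇ p)))
    wrap′-sum : ∑[ b < q ] wrap′ b ≡ (if a ≡ᵇ 0 then G a p else 0)
    wrap′-sum = trans (∑-if q (a ≡ᵇ 0) (λ b → if toℕ b ≡ᵇ p then h (toℕ b) else 0))
      (if-congᵀ (a ≡ᵇ 0) (λ t → trans (∑-δℕ q p h)
        (trans (if-T (h p) (<⇒<ᵇ (n<1+n p))) (if-T (G a p) (subst (λ z → T (z <ᵇ p)) (sym (≡ᵇ⇒≡ a 0 t)) _)))))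

  cycle-edge-sum : ∀ (G : ℕ → ℕ → ℕ) →
    ∑[ a < q ] ∑[ b < q ] (if cycleAdjℕ q (toℕ a) (toℕ b) ∧ (toℕ a <ᵇ toℕ b) then G (toℕ a) (toℕ b) else 0)
      ≡ ∑[ m < p ] G (toℕ m) (suc (toℕ m)) + G 0 p
  cycle-edge-sum G = begin
    ∑[ a < q ] ∑[ b < q ] (if cycleAdjℕ q (toℕ a) (toℕ b) ∧ (toℕ a <ᵇ toℕ b) then G (toℕ a) (toℕ b) else 0)
      ≡⟨ sum-cong-≗ {q} (λ a → forward-neighbours G (toℕ a)) ⟩
    ∑[ a < q ] (step (toℕ a) + start (toℕ a))
      ≡⟨ ∑-distrib-+ {q} (step ∘ toℕ) (start ∘ toℕ) ⟩
    ∑[ a < q ] step (toℕ a) + ∑[ a < q ] start (toℕ a)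
      ≡⟨ cong₂ _+_ path (∑-δℕ q 0 (λ a → G a p)) ⟩
    ∑[ m < p ] G (toℕ m) (suc (toℕ m)) + G 0 p ∎
    where
    open ≡-Reasoning
    step start : ℕ → ℕ
    step  a = if suc a <ᵇ q then G a (suc a) else 0
    start a = if a ≡ᵇ 0 then G a p else 0
    path : ∑[ a < q ] step (toℕ a) ≡ ∑[ m < p ] G (toℕ m) (suc (toℕ m))
    path = begin
      ∑[ a < q ] step (toℕ a)
        ≡⟨ ∑-last p step ⟩
      ∑[ m < p ] step (toℕ m) + step p
        ≡⟨ cong₂ _+_ (sum-cong-≗ {p} (λ m → if-T (G (toℕ m) (suc (toℕ m))) (<⇒<ᵇ (s≤s (toℕ<n m)))))
                     (if-F (G p (suc p)) (ℕ.<-irrefl refl ∘ <ᵇ⇒< (suc p) q)) ⟩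
      ∑[ m < p ] G (toℕ m) (suc (toℕ m)) + 0
        ≡⟨ ℕ.+-identityʳ _ ⟩
      ∑[ m < p ] G (toℕ m) (suc (toℕ m)) ∎

∣n-1+n∣≡1 : ∀ n → ∣ n - suc n ∣ ≡ 1
∣n-1+n∣≡1 zero    = refl
∣n-1+n∣≡1 (suc n) = ∣n-1+n∣≡1 n

Adjacent : ℕ → ℕ → ℕ → Set
Adjacent q a b = b ≡ suc a ⊎ a ≡ suc b ⊎ (a ≡ q ∸ 1 × b ≡ 0) ⊎ (b ≡ q ∸ 1 × a ≡ 0)

Adjacent-sym : ∀ {q a b} → Adjacent q a b → Adjacent q b a
Adjacent-sym (inj₁ b≡1+a)               = inj₂ (inj₁ b≡1+a)
Adjacent-sym (inj₂ (inj₁ a≡1+b))        = inj₁ a≡1+b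
Adjacent-sym (inj₂ (inj₂ (inj₁ wrap)))  = inj₂ (inj₂ (inj₂ wrap))
Adjacent-sym (inj₂ (inj₂ (inj₂ wrap′))) = inj₂ (inj₂ (inj₁ wrap′))

cycleDist-wrap : ∀ {q} (a b : Fin q) → ∣ toℕ a - toℕ b ∣ ≡ q ∸ 1 → cycleDist q a b ≤ 1
cycleDist-wrap {q} a b eq =
  ℕ.≤-trans (ℕ.m⊓n≤n _ _)
    (ℕ.≤-reflexive (trans (cong (q ∸_) eq) (ℕ.m∸[m∸n]≡n (ℕ.≤-trans (s≤s z≤n) (toℕ<n a)))))

cycleDist-≤1 : ∀ {q} (a b : Fin q) → toℕ a ≡ toℕ b ⊎ Adjacent q (toℕ a) (toℕ b) → cycleDist q a b ≤ 1
cycleDist-≤1 a b (inj₁ a≡b) =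
  ℕ.≤-trans (ℕ.m⊓n≤m _ _)
    (ℕ.≤-trans (ℕ.≤-reflexive (trans (cong (∣ toℕ a -_∣) (sym a≡b)) (ℕ.∣n-n∣≡0 (toℕ a)))) z≤n)
cycleDist-≤1 a b (inj₂ (inj₁ b≡1+a)) =
  ℕ.≤-trans (ℕ.m⊓n≤m _ _)
    (ℕ.≤-reflexive (trans (cong (∣ toℕ a -_∣) b≡1+a) (∣n-1+n∣≡1 (toℕ a))))
cycleDist-≤1 a b (inj₂ (inj₂ (inj₁ a≡1+b))) =
  ℕ.≤-trans (ℕ.m⊓n≤m _ _)
    (ℕ.≤-reflexive (trans (cong (∣_- toℕ b ∣) a≡1+b) (trans (ℕ.∣-∣-comm (suc (toℕ b)) (toℕ b)) (∣n-1+n∣≡1 (toℕ b)))))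
cycleDist-≤1 {q} a b (inj₂ (inj₂ (inj₂ (inj₁ (a≡q-1 , b≡0))))) =
  cycleDist-wrap a b (trans (cong₂ ∣_-_∣ a≡q-1 b≡0) (ℕ.∣-∣-comm (q ∸ 1) 0))
cycleDist-≤1 a b (inj₂ (inj₂ (inj₂ (inj₂ (b≡q-1 , a≡0))))) =
  cycleDist-wrap a b (cong₂ ∣_-_∣ a≡0 b≡q-1)

-- The link L_{q,h,k}

quotRem-combine : ∀ {k q} (i : Fin k) (a : Fin q) → quotRem q (combine i a) ≡ (a , i)
quotRem-combine i a = cong swap (remQuot-combine i a)

module Link {q k : ℕ} (x y : Fin k → Fin q) where

  adj : Adj (k * q)
  adj = linkAdj q k x y

  linkAdj-combine : ∀ i a j b → adj (combine i a) (combine j b)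
    ≡ (finEq i j ∧ cycleAdjℕ q (toℕ a) (toℕ b))
      ∨ ((toℕ j ≡ᵇ suc (toℕ i)) ∧ finEq a (y i) ∧ finEq b (x j))
      ∨ ((toℕ i ≡ᵇ suc (toℕ j)) ∧ finEq b (y j) ∧ finEq a (x i))
  linkAdj-combine i a j b rewrite quotRem-combine i a | quotRem-combine j b = refl

  link-indicator : ∀ i a j b z → (if adj (combine i a) (combine j b) then z else 0)
    ≡ (if finEq i j then (if cycleAdjℕ q (toℕ a) (toℕ b) then z else 0) else 0)
      + ((if toℕ j ≡ᵇ suc (toℕ i) then (if finEq a (y i) ∧ finEq b (x j) then z else 0) else 0)
        + (if toℕ i ≡ᵇ suc (toℕ j) then (if finEq b (y j) ∧ finEq a (x i) then z else 0) else 0))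
  link-indicator i a j b z = begin
    (if adj (combine i a) (combine j b) then z else 0)
      ≡⟨ cong (λ c → if c then z else 0) (linkAdj-combine i a j b) ⟩
    (if same ∨ next ∨ prev then z else 0)
      ≡⟨ if-∨-disjoint z (disjoint-∨ (disjoint-∧ same⊥next) (disjoint-∧ same⊥prev)) ⟩
    [ same ] + (if next ∨ prev then z else 0)
      ≡⟨ cong ([ same ] +_) (if-∨-disjoint z (disjoint-∧ next⊥prev)) ⟩
    [ same ] + ([ next ] + [ prev ])
      ≡⟨ cong₂ _+_ (if-∧ (finEq i j))
           (cong₂ _+_ (if-∧ (toℕ j ≡ᵇ suc (toℕ i))) (if-∧ (toℕ i ≡ᵇ suc (toℕ j)))) ⟩
    (if finEq i j then (if cycleAdjℕ q (toℕ a) (toℕ b) then z else 0) else 0)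
      + ((if toℕ j ≡ᵇ suc (toℕ i) then (if finEq a (y i) ∧ finEq b (x j) then z else 0) else 0)
        + (if toℕ i ≡ᵇ suc (toℕ j) then (if finEq b (y j) ∧ finEq a (x i) then z else 0) else 0)) ∎
    where
    open ≡-Reasoning
    [_] : Bool → ℕ
    [ c ] = if c then z else 0
    same next prev : Bool
    same = finEq i j ∧ cycleAdjℕ q (toℕ a) (toℕ b)
    next = (toℕ j ≡ᵇ suc (toℕ i)) ∧ finEq a (y i) ∧ finEq b (x j)
    prev = (toℕ i ≡ᵇ suc (toℕ j)) ∧ finEq b (y j) ∧ finEq a (x i)
    same⊥next : Disjoint (finEq i j) (toℕ j ≡ᵇ suc (toℕ i))
    same⊥next i≡j j≡1+i = ℕ.1+n≢n (sym (trans (cong toℕ (toWitness i≡j)) (≡ᵇ⇒≡ _ _ j≡1+i)))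
    same⊥prev : Disjoint (finEq i j) (toℕ i ≡ᵇ suc (toℕ j))
    same⊥prev i≡j i≡1+j = ℕ.1+n≢n (sym (trans (cong toℕ (sym (toWitness i≡j))) (≡ᵇ⇒≡ _ _ i≡1+j)))
    next⊥prev : Disjoint (toℕ j ≡ᵇ suc (toℕ i)) (toℕ i ≡ᵇ suc (toℕ j))
    next⊥prev j≡1+i i≡1+j =
      ℕ.<-asym (subst (toℕ i <_) (sym (≡ᵇ⇒≡ _ _ j≡1+i)) (n<1+n _)) (subst (toℕ j <_) (sym (≡ᵇ⇒≡ _ _ i≡1+j)) (n<1+n _))

  -- Number of link edges at the vertex (i, m): y_i carries one iff i + 1 < k, and x_i iff 0 < i.
  excess : Fin k → ℕ → ℕ
  excess i m = (if suc (toℕ i) <ᵇ k then (if m ≡ᵇ toℕ (y i) then 1 else 0) else 0)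
            + (if 0 <ᵇ toℕ i then (if m ≡ᵇ toℕ (x i) then 1 else 0) else 0)

  degree-combine : ∀ i a →
    degree adj (combine i a) ≡ ∑[ b < q ] (if cycleAdjℕ q (toℕ a) (toℕ b) then 1 else 0) + excess i (toℕ a)
  degree-combine i a = begin
    degree adj (combine i a)
      ≡⟨ degree-as-∑ adj (combine i a) ⟩
    ∑[ v < k * q ] [ adj (combine i a) v ]
      ≡⟨ ∑-combine k q (λ v → [ adj (combine i a) v ]) ⟩
    ∑[ j < k ] ∑[ b < q ] [ adj (combine i a) (combine j b) ]
      ≡⟨ sum-cong-≗ {k} (λ j → sum-cong-≗ {q} (λ b → link-indicator i a j b 1)) ⟩
    ∑[ j < k ] ∑[ b < q ] (same j b + (next j b + prev j b))
      ≡⟨ sum-cong-≗ {k} (λ j → trans (∑-distrib-+₃ q (same j) (next j) (prev j))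
           (cong₂ _+_ (∑-if q (finEq i j) _) (cong₂ _+_ (next-sum j) (prev-sum j)))) ⟩
    ∑[ j < k ] ((if finEq i j then cyc-degree else 0)
      + ((if toℕ j ≡ᵇ suc (toℕ i) then [ finEq a (y i) ] else 0) + (if toℕ i ≡ᵇ suc (toℕ j) then [ finEq a (x i) ] else 0)))
      ≡⟨ ∑-distrib-+₃ k _ _ _ ⟩
    ∑[ j < k ] (if finEq i j then cyc-degree else 0)
      + (∑[ j < k ] (if toℕ j ≡ᵇ suc (toℕ i) then [ finEq a (y i) ] else 0)
        + ∑[ j < k ] (if toℕ i ≡ᵇ suc (toℕ j) then [ finEq a (x i) ] else 0))
      ≡⟨ cong₂ _+_ (∑-δ i (λ _ → cyc-degree))
           (cong₂ _+_ (∑-δℕ k (suc (toℕ i)) (λ _ → [ finEq a (y i) ]))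
                      (∑-δℕ-pred k (toℕ i) _ (ℕ.<⇒≤ (toℕ<n i)))) ⟩
    cyc-degree + ((if suc (toℕ i) <ᵇ k then [ finEq a (y i) ] else 0) + (if 0 <ᵇ toℕ i then [ finEq a (x i) ] else 0))
      ≡⟨ cong₂ (λ c d → cyc-degree + ((if suc (toℕ i) <ᵇ k then [ c ] else 0) + (if 0 <ᵇ toℕ i then [ d ] else 0)))
           (finEq-toℕ a (y i)) (finEq-toℕ a (x i)) ⟩
    cyc-degree + excess i (toℕ a) ∎
    where
    open ≡-Reasoning
    [_] : Bool → ℕ
    [ c ] = if c then 1 else 0
    cyc-degree : ℕ
    cyc-degree = ∑[ b < q ] [ cycleAdjℕ q (toℕ a) (toℕ b) ]
    same next prev : Fin k → Fin q → ℕ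
    same j b = if finEq i j then [ cycleAdjℕ q (toℕ a) (toℕ b) ] else 0
    next j b = if toℕ j ≡ᵇ suc (toℕ i) then [ finEq a (y i) ∧ finEq b (x j) ] else 0
    prev j b = if toℕ i ≡ᵇ suc (toℕ j) then [ finEq b (y j) ∧ finEq a (x i) ] else 0
    next-sum : ∀ j → ∑[ b < q ] next j b ≡ (if toℕ j ≡ᵇ suc (toℕ i) then [ finEq a (y i) ] else 0)
    next-sum j = trans (∑-if q (toℕ j ≡ᵇ suc (toℕ i)) _) (cong (λ n → if toℕ j ≡ᵇ suc (toℕ i) then n else 0)
      (trans (sum-cong-≗ {q} (λ b → if-∧ (finEq a (y i))))
        (trans (∑-if q (finEq a (y i)) _) (cong (λ n → if finEq a (y i) then n else 0) (∑-δʳ (x j) (λ _ → 1))))))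
    prev-sum : ∀ j → ∑[ b < q ] prev j b ≡ (if toℕ i ≡ᵇ suc (toℕ j) then [ finEq a (x i) ] else 0)
    prev-sum j = trans (∑-if q (toℕ i ≡ᵇ suc (toℕ j)) _) (cong (λ n → if toℕ i ≡ᵇ suc (toℕ j) then n else 0)
      (trans (sum-cong-≗ {q} (λ b → trans (if-∧ (finEq b (y j))) (if-swap-then (finEq b (y j)) (finEq a (x i)))))
        (trans (∑-if q (finEq a (x i)) _) (cong (λ n → if finEq a (x i) then n else 0) (∑-δʳ (y j) (λ _ → 1))))))

  combine-<ᵇ-same : ∀ (i : Fin k) (a b : Fin q) → (toℕ (combine i a) <ᵇ toℕ (combine i b)) ≡ (toℕ a <ᵇ toℕ b)
  combine-<ᵇ-same i a b rewrite toℕ-combine i a | toℕ-combine i b = +-<ᵇ (q * toℕ i) (toℕ a) (toℕ b)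

  edge-indicator : ∀ (w : Fin (k * q) → Fin (k * q) → ℕ) i a j b →
    let u = combine i a ; v = combine j b in
    (if adj u v ∧ (toℕ u <ᵇ toℕ v) then w u v else 0)
      ≡ (if finEq i j then (if cycleAdjℕ q (toℕ a) (toℕ b) then (if toℕ u <ᵇ toℕ v then w u v else 0) else 0) else 0)
        + (if toℕ j ≡ᵇ suc (toℕ i) then (if finEq a (y i) ∧ finEq b (x j) then w u v else 0) else 0)
  edge-indicator w i a j b = begin
    (if adj u v ∧ u<v then w u v else 0)
      ≡⟨ if-∧ (adj u v) ⟩
    (if adj u v then (if u<v then w u v else 0) else 0)
      ≡⟨ link-indicator i a j b _ ⟩
    S + (N + P)
      ≡⟨ cong (S +_) (cong₂ _+_ N-forward P-vanishes) ⟩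
    S + ((if toℕ j ≡ᵇ suc (toℕ i) then (if finEq a (y i) ∧ finEq b (x j) then w u v else 0) else 0) + 0)
      ≡⟨ cong (S +_) (ℕ.+-identityʳ _) ⟩
    S + (if toℕ j ≡ᵇ suc (toℕ i) then (if finEq a (y i) ∧ finEq b (x j) then w u v else 0) else 0) ∎
    where
    open ≡-Reasoning
    u = combine i a
    v = combine j b
    u<v = toℕ u <ᵇ toℕ v
    S N P : ℕ
    S = if finEq i j then (if cycleAdjℕ q (toℕ a) (toℕ b) then (if u<v then w u v else 0) else 0) else 0
    N = if toℕ j ≡ᵇ suc (toℕ i) then (if finEq a (y i) ∧ finEq b (x j) then (if u<v then w u v else 0) else 0) else 0
    P = if toℕ i ≡ᵇ suc (toℕ j) then (if finEq b (y j) ∧ finEq a (x i) then (if u<v then w u v else 0) else 0) else 0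
    N-forward : N ≡ (if toℕ j ≡ᵇ suc (toℕ i) then (if finEq a (y i) ∧ finEq b (x j) then w u v else 0) else 0)
    N-forward = if-congᵀ (toℕ j ≡ᵇ suc (toℕ i)) (λ j≡1+i → if-congᵀ (finEq a (y i) ∧ finEq b (x j)) (λ _ →
      if-T (w u v) (<⇒<ᵇ (combine-monoˡ-< a b (subst (toℕ i <_) (sym (≡ᵇ⇒≡ _ _ j≡1+i)) (n<1+n (toℕ i)))))))
    P-vanishes : P ≡ 0
    P-vanishes = trans (if-congᵀ (toℕ i ≡ᵇ suc (toℕ j)) (λ i≡1+j →
        trans (if-congᵀ (finEq b (y j) ∧ finEq a (x i)) (λ _ → if-F (w u v) (λ lt → ℕ.<-asym (<ᵇ⇒< _ _ lt)
                (combine-monoˡ-< b a (subst (toℕ j <_) (sym (≡ᵇ⇒≡ _ _ i≡1+j)) (n<1+n (toℕ j)))))))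
              (if-eta (finEq b (y j) ∧ finEq a (x i)))))
      (if-eta (toℕ i ≡ᵇ suc (toℕ j)))

  ∑edges-link : ∀ (w : Fin (k * q) → Fin (k * q) → ℕ) → ∑edges adj w
    ≡ ∑[ i < k ] ∑[ a < q ] ∑[ b < q ]
        (if cycleAdjℕ q (toℕ a) (toℕ b) ∧ (toℕ a <ᵇ toℕ b) then w (combine i a) (combine i b) else 0)
      + ∑[ i < k ] ∑[ j < k ] (if toℕ j ≡ᵇ suc (toℕ i) then w (combine i (y i)) (combine j (x j)) else 0)
  ∑edges-link w = begin
    ∑edges adj w
      ≡⟨ ∑edges-as-∑∑ adj w ⟩
    ∑[ u < k * q ] ∑[ v < k * q ] edge u v
      ≡⟨ ∑-combine k q (λ u → ∑[ v < k * q ] edge u v) ⟩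
    ∑[ i < k ] ∑[ a < q ] ∑[ v < k * q ] edge (combine i a) v
      ≡⟨ sum-cong-≗ {k} (λ i → sum-cong-≗ {q} (λ a → trans (∑-combine k q (edge (combine i a)))
           (sum-cong-≗ {k} (λ j → sum-cong-≗ {q} (λ b → edge-indicator w i a j b))))) ⟩
    ∑[ i < k ] ∑[ a < q ] ∑[ j < k ] ∑[ b < q ] (same i a j b + next i a j b)
      ≡⟨ sum-cong-≗ {k} (λ i → trans (sum-cong-≗ {q} (from-copy i)) (∑-distrib-+ {q} (cycle-part i) (link-part i))) ⟩
    ∑[ i < k ] (∑[ a < q ] cycle-part i a + ∑[ a < q ] link-part i a)
      ≡⟨ ∑-distrib-+ {k} (λ i → ∑[ a < q ] cycle-part i a) (λ i → ∑[ a < q ] link-part i a) ⟩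
    ∑[ i < k ] ∑[ a < q ] cycle-part i a + ∑[ i < k ] ∑[ a < q ] link-part i a
      ≡⟨ cong (∑[ i < k ] ∑[ a < q ] cycle-part i a +_) (sum-cong-≗ {k} link-at-y) ⟩
    ∑[ i < k ] ∑[ a < q ] cycle-part i a
      + ∑[ i < k ] ∑[ j < k ] (if toℕ j ≡ᵇ suc (toℕ i) then w (combine i (y i)) (combine j (x j)) else 0) ∎
    where
    open ≡-Reasoning
    edge : Fin (k * q) → Fin (k * q) → ℕ
    edge u v = if adj u v ∧ (toℕ u <ᵇ toℕ v) then w u v else 0
    same next : Fin k → Fin q → Fin k → Fin q → ℕ
    same i a j b = if finEq i j then (if cycleAdjℕ q (toℕ a) (toℕ b)
      then (if toℕ (combine i a) <ᵇ toℕ (combine j b) then w (combine i a) (combine j b) else 0) else 0) else 0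
    next i a j b = if toℕ j ≡ᵇ suc (toℕ i)
      then (if finEq a (y i) ∧ finEq b (x j) then w (combine i a) (combine j b) else 0) else 0
    cycle-part link-part : Fin k → Fin q → ℕ
    cycle-part i a =
      ∑[ b < q ] (if cycleAdjℕ q (toℕ a) (toℕ b) ∧ (toℕ a <ᵇ toℕ b) then w (combine i a) (combine i b) else 0)
    link-part i a =
      ∑[ j < k ] (if toℕ j ≡ᵇ suc (toℕ i) then (if finEq a (y i) then w (combine i a) (combine j (x j)) else 0) else 0)
    same-sum : ∀ i a → ∑[ j < k ] ∑[ b < q ] same i a j b ≡ cycle-part i a
    same-sum i a = trans (sum-cong-≗ {k} (λ j → ∑-if q (finEq i j) _)) (trans (∑-δ i _)
      (sum-cong-≗ {q} (λ b → trans
        (cong (λ c → if cycleAdjℕ q (toℕ a) (toℕ b) then (if c then w (combine i a) (combine i b) else 0) else 0)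
              (combine-<ᵇ-same i a b))
        (sym (if-∧ (cycleAdjℕ q (toℕ a) (toℕ b)))))))
    next-sum : ∀ i a j → ∑[ b < q ] next i a j b
      ≡ (if toℕ j ≡ᵇ suc (toℕ i) then (if finEq a (y i) then w (combine i a) (combine j (x j)) else 0) else 0)
    next-sum i a j = trans (∑-if q (toℕ j ≡ᵇ suc (toℕ i)) _) (cong (λ n → if toℕ j ≡ᵇ suc (toℕ i) then n else 0)
      (trans (sum-cong-≗ {q} (λ b → if-∧ (finEq a (y i))))
        (trans (∑-if q (finEq a (y i)) _) (cong (λ n → if finEq a (y i) then n else 0) (∑-δʳ (x j) _)))))
    from-copy : ∀ i a → ∑[ j < k ] ∑[ b < q ] (same i a j b + next i a j b) ≡ cycle-part i a + link-part i a
    from-copy i a = begin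
      ∑[ j < k ] ∑[ b < q ] (same i a j b + next i a j b)
        ≡⟨ sum-cong-≗ {k} (λ j → ∑-distrib-+ {q} (same i a j) (next i a j)) ⟩
      ∑[ j < k ] (∑[ b < q ] same i a j b + ∑[ b < q ] next i a j b)
        ≡⟨ ∑-distrib-+ {k} (λ j → ∑[ b < q ] same i a j b) (λ j → ∑[ b < q ] next i a j b) ⟩
      ∑[ j < k ] ∑[ b < q ] same i a j b + ∑[ j < k ] ∑[ b < q ] next i a j b
        ≡⟨ cong₂ _+_ (same-sum i a) (sum-cong-≗ {k} (next-sum i a)) ⟩
      cycle-part i a + link-part i a ∎
    link-at-y : ∀ i → ∑[ a < q ] link-part i a
      ≡ ∑[ j < k ] (if toℕ j ≡ᵇ suc (toℕ i) then w (combine i (y i)) (combine j (x j)) else 0)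
    link-at-y i = trans
      (sum-cong-≗ {q} (λ a → trans (sum-cong-≗ {k} (λ j → if-swap-then (toℕ j ≡ᵇ suc (toℕ i)) (finEq a (y i))))
                                   (∑-if k (finEq a (y i)) _)))
      (∑-δʳ (y i) _)

-- Attachment vertices at distance at least 2

matches : ℕ → ℕ → ℕ → ℕ
matches X Y m = (if m ≡ᵇ Y then 1 else 0) + (if m ≡ᵇ X then 1 else 0)

matches≡0 : ∀ {X Y m} → m ≢ Y → m ≢ X → matches X Y m ≡ 0
matches≡0 {X} {Y} {m} m≢Y m≢X = cong₂ _+_ (if-F 1 (m≢Y ∘ ≡ᵇ⇒≡ m Y)) (if-F 1 (m≢X ∘ ≡ᵇ⇒≡ m X))

matches≤1 : ∀ {X Y} m → X ≢ Y → matches X Y m ≤ 1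
matches≤1 {X} {Y} m X≢Y with m ℕ.≟ Y
... | yes m≡Y =
  ℕ.≤-reflexive (cong₂ _+_ (if-T 1 (≡⇒≡ᵇ m Y m≡Y)) (if-F 1 (λ m≡X → X≢Y (trans (sym (≡ᵇ⇒≡ m X m≡X)) m≡Y))))
... | no  m≢Y = subst (_≤ 1) (cong (_+ _) (sym (if-F 1 (m≢Y ∘ ≡ᵇ⇒≡ m Y)))) (if≤ (m ≡ᵇ X) 1)

matches-pair : ∀ {X Y m n} → X ≢ Y → m ≢ n → (m ≡ X → n ≢ Y) → (m ≡ Y → n ≢ X) →
  matches X Y m + matches X Y n ≤ 1
matches-pair {X} {Y} {m} {n} X≢Y m≢n xy yx with m ℕ.≟ Y | m ℕ.≟ X
... | yes m≡Y | _ = ℕ.≤-trans (ℕ.≤-reflexive (trans (cong (matches X Y m +_)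
        (matches≡0 (λ n≡Y → m≢n (trans m≡Y (sym n≡Y))) (yx m≡Y))) (ℕ.+-identityʳ _))) (matches≤1 m X≢Y)
... | no _    | yes m≡X = ℕ.≤-trans (ℕ.≤-reflexive (trans (cong (matches X Y m +_)
        (matches≡0 (xy m≡X) (λ n≡X → m≢n (trans m≡X (sym n≡X))))) (ℕ.+-identityʳ _))) (matches≤1 m X≢Y)
... | no m≢Y  | no m≢X = subst (_≤ 1) (cong (_+ matches X Y n) (sym (matches≡0 m≢Y m≢X))) (matches≤1 n X≢Y)

√13-part-cycle : ∀ {u v} → u + v ≤ 1 → √13-part (2 + u) (2 + v) ≡ u + v
√13-part-cycle {0}           {0}           _ = refl
√13-part-cycle {0}           {1}           _ = refl
√13-part-cycle {1}           {0}           _ = refl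
√13-part-cycle {0}           {suc (suc _)} (s≤s ())
√13-part-cycle {1}           {suc _}       (s≤s ())
√13-part-cycle {suc (suc _)} {_}           (s≤s ())

√2-part+2√13-part-cycle : ∀ {u v} → u + v ≤ 1 → √2-part (2 + u) (2 + v) + 2 * √13-part (2 + u) (2 + v) ≡ 2
√2-part+2√13-part-cycle {0}           {0}           _ = refl
√2-part+2√13-part-cycle {0}           {1}           _ = refl
√2-part+2√13-part-cycle {1}           {0}           _ = refl
√2-part+2√13-part-cycle {0}           {suc (suc _)} (s≤s ())
√2-part+2√13-part-cycle {1}           {suc _}       (s≤s ())
√2-part+2√13-part-cycle {suc (suc _)} {_}           (s≤s ())

module SeparatedLink (r K : ℕ) (x y : Fin (suc K) → Fin (3 + r))
  (separated : ∀ i → 2 ≤ cycleDist (3 + r) (x i) (y i)) where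

  open Cycle r
  open Link x y

  k : ℕ
  k = suc K

  X Y : Fin k → ℕ
  X i = toℕ (x i)
  Y i = toℕ (y i)

  private
    2≰1 : ¬ 2 ≤ 1
    2≰1 (s≤s ())

  x≢y : ∀ i → X i ≢ Y i
  x≢y i X≡Y = 2≰1 (ℕ.≤-trans (separated i) (cycleDist-≤1 (x i) (y i) (inj₁ X≡Y)))

  x≁y : ∀ i → ¬ Adjacent q (X i) (Y i)
  x≁y i x~y = 2≰1 (ℕ.≤-trans (separated i) (cycleDist-≤1 (x i) (y i) (inj₂ x~y)))

  excess≤matches : ∀ i m → excess i m ≤ matches (X i) (Y i) m
  excess≤matches i m = ℕ.+-mono-≤ (if≤ (suc (toℕ i) <ᵇ k) _) (if≤ (0 <ᵇ toℕ i) _)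

  excess≤1 : ∀ i m → excess i m ≤ 1
  excess≤1 i m = ℕ.≤-trans (excess≤matches i m) (matches≤1 m (x≢y i))

  excess-adjacent : ∀ i {m n} → m ≢ n → Adjacent q m n → excess i m + excess i n ≤ 1
  excess-adjacent i {m} {n} m≢n m~n =
    ℕ.≤-trans (ℕ.+-mono-≤ (excess≤matches i m) (excess≤matches i n)) (matches-pair (x≢y i) m≢n
    (λ m≡X n≡Y → x≁y i (subst₂ (Adjacent q) m≡X n≡Y m~n))
    (λ m≡Y n≡X → x≁y i (Adjacent-sym {q} (subst₂ (Adjacent q) m≡Y n≡X m~n))))

  excess-at-y : ∀ i → suc (toℕ i) < k → excess i (Y i) ≡ 1
  excess-at-y i i+1<k = cong₂ _+_
    (trans (if-T _ (<⇒<ᵇ i+1<k)) (if-T 1 (≡⇒≡ᵇ (Y i) (Y i) refl)))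
    (trans (if-congᵀ (0 <ᵇ toℕ i) (λ _ → if-F 1 (λ Y≡X → x≢y i (sym (≡ᵇ⇒≡ (Y i) (X i) Y≡X)))))
           (if-eta (0 <ᵇ toℕ i)))

  excess-at-x : ∀ j → 0 < toℕ j → excess j (X j) ≡ 1
  excess-at-x j 0<j = cong₂ _+_
    (trans (if-congᵀ (suc (toℕ j) <ᵇ k) (λ _ → if-F 1 (x≢y j ∘ ≡ᵇ⇒≡ (X j) (Y j)))) (if-eta (suc (toℕ j) <ᵇ k)))
    (trans (if-T _ (<⇒<ᵇ 0<j)) (if-T 1 (≡⇒≡ᵇ (X j) (X j) refl)))

  degree-link : ∀ i a → degree adj (combine i a) ≡ 2 + excess i (toℕ a)
  degree-link i a = trans (degree-combine i a) (cong (_+ excess i (toℕ a)) (cycle-degree (toℕ a) (ℕ.≤-pred (toℕ<n a))))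

  degree-2or3 : ∀ u → Is2or3 (degree adj u)
  degree-2or3 u = subst (Is2or3 ∘ degree adj) (combine-remQuot {k} q u) (at-block (remQuot {k} q u))
    where
    2+≤1 : ∀ {e} → e ≤ 1 → Is2or3 (2 + e)
    2+≤1 z≤n       = inj₁ refl
    2+≤1 (s≤s z≤n) = inj₂ refl
    at-block : ∀ ia → Is2or3 (degree adj (uncurry combine ia))
    at-block (i , a) = subst Is2or3 (sym (degree-link i a)) (2+≤1 (excess≤1 i (toℕ a)))

  copy-edge-sum : (ℕ → ℕ → ℕ) → Fin k → ℕ
  copy-edge-sum f i = ∑[ m < p ] f (2 + excess i (toℕ m)) (2 + excess i (suc (toℕ m))) + f (2 + excess i 0) (2 + excess i p)

  ∑edges-of-degrees : ∀ (f : ℕ → ℕ → ℕ) →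
    ∑edges adj (λ u v → f (degree adj u) (degree adj v)) ≡ ∑[ i < k ] copy-edge-sum f i + K * f 3 3
  ∑edges-of-degrees f = begin
    ∑edges adj (λ u v → f (degree adj u) (degree adj v))
      ≡⟨ ∑edges-link _ ⟩
    ∑[ i < k ] ∑[ a < q ] ∑[ b < q ] cycle-edge i a b + ∑[ i < k ] ∑[ j < k ] link-edge i j
      ≡⟨ cong₂ _+_ (sum-cong-≗ {k} copy) (sum-cong-≗ {k} links-from) ⟩
    ∑[ i < k ] copy-edge-sum f i + ∑[ i < k ] (if toℕ i <ᵇ K then f 3 3 else 0)
      ≡⟨ cong (∑[ i < k ] copy-edge-sum f i +_)
           (trans (∑-count-< k K (f 3 3)) (cong (_* f 3 3) (ℕ.m≥n⇒m⊓n≡n (ℕ.n≤1+n K)))) ⟩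
    ∑[ i < k ] copy-edge-sum f i + K * f 3 3 ∎
    where
    open ≡-Reasoning
    w : Fin (k * q) → Fin (k * q) → ℕ
    w u v = f (degree adj u) (degree adj v)
    cycle-edge : Fin k → Fin q → Fin q → ℕ
    cycle-edge i a b = if cycleAdjℕ q (toℕ a) (toℕ b) ∧ (toℕ a <ᵇ toℕ b) then w (combine i a) (combine i b) else 0
    link-edge : Fin k → Fin k → ℕ
    link-edge i j = if toℕ j ≡ᵇ suc (toℕ i) then w (combine i (y i)) (combine j (x j)) else 0
    copy : ∀ i → ∑[ a < q ] ∑[ b < q ] cycle-edge i a b ≡ copy-edge-sum f i
    copy i = trans (sum-cong-≗ {q} (λ a → sum-cong-≗ {q} (λ b →
        cong₂ (λ d d′ → if cycleAdjℕ q (toℕ a) (toℕ b) ∧ (toℕ a <ᵇ toℕ b) then f d d′ else 0)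
              (degree-link i a) (degree-link i b))))
      (cycle-edge-sum (λ m n → f (2 + excess i m) (2 + excess i n)))
    links-from : ∀ i → ∑[ j < k ] link-edge i j ≡ (if toℕ i <ᵇ K then f 3 3 else 0)
    links-from i = trans (sum-cong-≗ {k} (λ j → if-congᵀ (toℕ j ≡ᵇ suc (toℕ i)) (λ j≡1+i →
        let j≡1+i = ≡ᵇ⇒≡ (toℕ j) (suc (toℕ i)) j≡1+i in
        cong₂ f (trans (degree-link i (y i)) (cong (2 +_) (excess-at-y i (subst (_< k) j≡1+i (toℕ<n j)))))
                (trans (degree-link j (x j)) (cong (2 +_) (excess-at-x j (subst (0 <_) (sym j≡1+i) (s≤s z≤n))))))))
      (∑-δℕ k (suc (toℕ i)) (λ _ → f 3 3))

  link-ends : Fin k → ℕ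
  link-ends i = (if suc (toℕ i) <ᵇ k then 1 else 0) + (if 0 <ᵇ toℕ i then 1 else 0)

  ∑-excess : ∀ i → ∑[ m < q ] excess i (toℕ m) ≡ link-ends i
  ∑-excess i = trans (∑-distrib-+ {q} (at (suc (toℕ i) <ᵇ k) (Y i)) (at (0 <ᵇ toℕ i) (X i)))
    (cong₂ _+_ (∑-at (suc (toℕ i) <ᵇ k) (y i)) (∑-at (0 <ᵇ toℕ i) (x i)))
    where
    at : Bool → ℕ → Fin q → ℕ
    at c v m = if c then (if toℕ m ≡ᵇ v then 1 else 0) else 0
    ∑-at : ∀ c (v : Fin q) → ∑[ m < q ] at c (toℕ v) m ≡ (if c then 1 else 0)
    ∑-at c v = trans (∑-if q c (λ m → if toℕ m ≡ᵇ toℕ v then 1 else 0))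
      (if-congᵀ c (λ _ → trans (∑-δℕ q (toℕ v) (λ _ → 1)) (if-T 1 (<⇒<ᵇ (toℕ<n v)))))

  ∑-link-ends : ∑[ i < k ] link-ends i ≡ K + K
  ∑-link-ends = trans (∑-distrib-+ {k} (λ i → if suc (toℕ i) <ᵇ k then 1 else 0) (λ i → if 0 <ᵇ toℕ i then 1 else 0))
    (cong₂ _+_ (trans (∑-count-< k K 1) (trans (cong (_* 1) (ℕ.m≥n⇒m⊓n≡n (ℕ.n≤1+n K))) (ℕ.*-identityʳ K)))
               (trans (∑-const K 1) (ℕ.*-identityʳ K)))

  cycle-pairs-adjacent : ∀ i (f : ℕ → ℕ → ℕ) (g : ℕ → ℕ → ℕ) →
    (∀ {u v} → u + v ≤ 1 → f (2 + u) (2 + v) ≡ g u v) →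
    copy-edge-sum f i ≡ ∑[ m < p ] g (excess i (toℕ m)) (excess i (suc (toℕ m))) + g (excess i 0) (excess i p)
  cycle-pairs-adjacent i f g on-edge = cong₂ _+_
    (sum-cong-≗ {p} (λ m → on-edge {excess i (toℕ m)} {excess i (suc (toℕ m))}
      (excess-adjacent i {toℕ m} {suc (toℕ m)} (λ m≡1+m → ℕ.1+n≢n (sym m≡1+m)) (inj₁ refl))))
    (on-edge {excess i 0} {excess i p} (excess-adjacent i {0} {p} (λ ()) (inj₂ (inj₂ (inj₂ (refl , refl))))))

  √13-count : √13-coefficient adj ≡ 4 * K
  √13-count = begin
    √13-coefficient adj
      ≡⟨ ∑edges-of-degrees √13-part ⟩
    ∑[ i < k ] copy-edge-sum √13-part i + K * 0
      ≡⟨ cong₂ _+_ (sum-cong-≗ {k} per-copy) (ℕ.*-zeroʳ K) ⟩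
    ∑[ i < k ] (link-ends i + link-ends i) + 0
      ≡⟨ trans (ℕ.+-identityʳ _) (trans (∑-distrib-+ {k} link-ends link-ends) (cong₂ _+_ ∑-link-ends ∑-link-ends)) ⟩
    (K + K) + (K + K)
      ≡⟨ solve 1 (λ K → (K :+ K) :+ (K :+ K) := con 4 :* K) refl K ⟩
    4 * K ∎
    where
    open ≡-Reasoning
    per-copy : ∀ i → copy-edge-sum √13-part i ≡ link-ends i + link-ends i
    per-copy i = trans (cycle-pairs-adjacent i √13-part _+_ (λ {u} {v} → √13-part-cycle {u} {v}))
      (trans (∑-cycle-pairs p (excess i)) (cong₂ _+_ (∑-excess i) (∑-excess i)))

  √2-plus-2√13-count : √2-coefficient adj + 2 * √13-coefficient adj ≡ k * (p * 2 + 2) + K * 3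
  √2-plus-2√13-count = begin
    √2-coefficient adj + 2 * √13-coefficient adj
      ≡⟨ sym (sum-map-+* (uncurry (λ u v → √2-part (degree adj u) (degree adj v)))
                         (uncurry (λ u v → √13-part (degree adj u) (degree adj v))) 2 (edges adj)) ⟩
    ∑edges adj (λ u v → g (degree adj u) (degree adj v))
      ≡⟨ ∑edges-of-degrees g ⟩
    ∑[ i < k ] copy-edge-sum g i + K * 3
      ≡⟨ cong (_+ K * 3) (trans (sum-cong-≗ {k} per-copy) (∑-const k (p * 2 + 2))) ⟩
    k * (p * 2 + 2) + K * 3 ∎
    where
    open ≡-Reasoning
    g : ℕ → ℕ → ℕ
    g d d′ = √2-part d d′ + 2 * √13-part d d′
    per-copy : ∀ i → copy-edge-sum g i ≡ p * 2 + 2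
    per-copy i = trans (cycle-pairs-adjacent i g (λ _ _ → 2) (λ {u} {v} → √2-part+2√13-part-cycle {u} {v})) (cong (_+ 2) (∑-const p 2))

  √2-count : √2-coefficient adj + 5 * k ≡ 2 * q * k + 5
  √2-count = ℕ.+-cancelʳ-≡ (K * 3) _ _ (begin
    N₂ + 5 * k + K * 3
      ≡⟨ solve 2 (λ N K → N :+ con 5 :* (con 1 :+ K) :+ K :* con 3 := N :+ con 2 :* (con 4 :* K) :+ con 5) refl N₂ K ⟩
    N₂ + 2 * (4 * K) + 5
      ≡⟨ cong (λ z → N₂ + 2 * z + 5) (sym √13-count) ⟩
    N₂ + 2 * N₁₃ + 5
      ≡⟨ cong (_+ 5) √2-plus-2√13-count ⟩
    k * (p * 2 + 2) + K * 3 + 5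
      ≡⟨ solve 2 (λ r K → (con 1 :+ K) :* ((con 2 :+ r) :* con 2 :+ con 2) :+ K :* con 3 :+ con 5
                        := con 2 :* (con 3 :+ r) :* (con 1 :+ K) :+ con 5 :+ K :* con 3) refl r K ⟩
    2 * q * k + 5 + K * 3 ∎)
    where
    open ≡-Reasoning
    N₂ N₁₃ : ℕ
    N₂  = √2-coefficient adj
    N₁₃ = √13-coefficient adj

  √13-count+4 : √13-coefficient adj + 4 ≡ 4 * k
  √13-count+4 = trans (cong (_+ 4) √13-count) (solve 1 (λ K → con 4 :* K :+ con 4 := con 4 :* (con 1 :+ K)) refl K)

mainTheorem9 : ∀ {c ℓ : Level} (R : CommutativeRing c ℓ) (S : SqrtOn R)
    (q h k : ℕ) → 1 ≤ k → 2 ≤ h → h ≤ q / 2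
    → (x y : Fin k → Fin q) → (∀ i → cycleDist q (x i) (y i) ≡ h)
    → CommutativeRing._≈_ R (SO R S (linkAdj q k x y))
        (CommutativeRing._+_ R
          (CommutativeRing._*_ R
            (CommutativeRing._+_ R
              (CommutativeRing._-_ R (fromℕ R (2 * q * k)) (fromℕ R (5 * k)))
              (fromℕ R 5))
            (SqrtOn.√_ S 2))
          (CommutativeRing._*_ R
            (CommutativeRing._-_ R (fromℕ R (4 * k)) (fromℕ R 4))
            (SqrtOn.√_ S 13)))
-- The bound h ≤ q / 2 only serves to exclude q ≤ 2.
mainTheorem9 R S 0 h k _ (s≤s (s≤s _)) ()
mainTheorem9 R S 1 h k _ (s≤s (s≤s _)) ()
mainTheorem9 R S 2 h k _ (s≤s (s≤s _)) (s≤s ())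
mainTheorem9 R S q@(suc (suc (suc r))) h k@(suc K) _ 2≤h _ x y dist-h = begin
  SO R S adj
    ≈⟨ SO-of-2-3-degrees R S adj degree-2or3 ⟩
  fromℕ R (√2-coefficient adj) *ᴿ √ 2 +ᴿ fromℕ R (√13-coefficient adj) *ᴿ √ 13
    ≈⟨ +-cong (*-congʳ (fromℕ-rearrange R S _ (5 * k) (2 * q * k) 5 √2-count))
              (*-congʳ (fromℕ-cancel R S _ 4 (4 * k) √13-count+4)) ⟩
  ((fromℕ R (2 * q * k) - fromℕ R (5 * k)) +ᴿ fromℕ R 5) *ᴿ √ 2 +ᴿ (fromℕ R (4 * k) - fromℕ R 4) *ᴿ √ 13 ∎
  where
  open CommutativeRing R using (_-_; +-cong; *-congʳ; setoid) renaming (_+_ to _+ᴿ_; _*_ to _*ᴿ_)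
  open SqrtOn S using (√_)
  open import Relation.Binary.Reasoning.Setoid setoid
  open Link x y using (adj)
  open SeparatedLink r K x y (λ i → subst (2 ≤_) (sym (dist-h i)) 2≤h) using (degree-2or3; √2-count; √13-count+4)
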